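{- Let $(Q,\mathbf{z})$ be a labeled directed graph which is a model for a tropical Plücker vector $\pi_\bullet\in\mathrm{Dr}(k,n)$. Then for every $v\in V(Q)$ such that $M_v$ is nonempty, $M_v=M(\pi^{ -\mathbf{b}_v}_\bullet)$, and in particular $M_v$ is (the set of bases of) a matroid.
   Context: Fix $k\ge2$. $Q$ is a finite loopless directed graph; for each edge $v\to w$, $\delta(v,w)=1$ and $\delta(w,v)=k-1$ (assuming no shorter path), and in general $\delta(v,w)$ is the minimum total cost of a path from $v$ to $w$ with forward edges costing $1$ and backward edges costing $k-1$. $\mathbf{z}=(z_1,\dots,z_n)\in V(Q)^n$. For $I\in\binom{[n]}{k}$, $\Sigma_Q(I)=\min_{x\in V(Q)}\sum_{i\in I}\delta(x,z_i)$, and $x$ attaining the minimum is a distance minimizer for $I$. $(Q,\mathbf{z})$ is a model for $\pi$ if $\pi_I=-\frac1k\Sigma_Q(I)$ for all $I$. $M_v=\{I:v\text{ is a distance minimizer for }I\}$. $\mathbf{b}_v=\frac1k(\delta(v,z_1),\dots,\delta(v,z_n))$. For $\mathbf{x}\in\mathbb{R}^n$, $\pi^{\mathbf{x}}_I=\pi_I-\sum_{i\in I}x_i$ and $M(\pi^{\mathbf{x}})=\{I:\pi^{\mathbf{x}}_I=\min_J\pi^{\mathbf{x}}_J\}$. $\mathrm{Dr}(k,n)$: vectors satisfying the three-term tropical Plücker relations (for $S\in\binom{[n]}{k-2}$, $a<b<c<d$ outside $S$, the minimum of $\pi_{Sab}+\pi_{Scd},\pi_{Sac}+\pi_{Sbd},\pi_{Sad}+\pi_{Sbc}$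 is attained twice). -}

module Defs where

open import Data.Nat as ℕ using (ℕ; zero; suc; _∸_)
open import Data.Integer as ℤ using (ℤ)
open import Data.Rational as ℚ using (ℚ; 0ℚ)
open import Data.Fin using (Fin; zero; suc; _<_)
open import Data.Fin.Subset using (Subset; _∈_; _∉_; _∪_; _-_; ⁅_⁆; ∣_∣)
open import Data.Vec using ([]; _∷_)
open import Data.Bool using (Bool; true; false)
open import Data.Product using (Σ; ∃; ∃-syntax; _×_; _,_)
open import Data.Sum using (_⊎_)
open import Relation.Binary.PropositionalEquality using (_≡_)

record Digraph : Set where
  field
    m        : ℕ
    E        : Fin m → Fin m → Bool
    loopless : ∀ v → E v v ≡ false
open Digraph public

data Walk (k : ℕ) (Q : Digraph) : Fin (m Q) → Fin (m Q) → ℕ → Set where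
  nil : ∀ {v} → Walk k Q v v 0
  fwd : ∀ {v u w c} → E Q v u ≡ true → Walk k Q u w c → Walk k Q v w (suc c)
  bwd : ∀ {v u w c} → E Q u v ≡ true → Walk k Q u w c → Walk k Q v w ((k ∸ 1) ℕ.+ c)

IsMinCost : (k : ℕ) (Q : Digraph) → Fin (m Q) → Fin (m Q) → ℕ → Set
IsMinCost k Q v w d = Walk k Q v w d × (∀ c → Walk k Q v w c → d ℕ.≤ c)

-- δ is the distance function δ(v,w) of Q (exists iff Q is connected).
IsDistance : (k : ℕ) (Q : Digraph) → (Fin (m Q) → Fin (m Q) → ℕ) → Set
IsDistance k Q δ = ∀ v w → IsMinCost k Q v w (δ v w)

sumℕ : ∀ {n} → Subset n → (Fin n → ℕ) → ℕ
sumℕ {zero}  []          f = 0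
sumℕ {suc n} (true  ∷ I) f = f zero ℕ.+ sumℕ I (λ i → f (suc i))
sumℕ {suc n} (false ∷ I) f = sumℕ I (λ i → f (suc i))

sumℚ : ∀ {n} → Subset n → (Fin n → ℚ) → ℚ
sumℚ {zero}  []          f = 0ℚ
sumℚ {suc n} (true  ∷ I) f = f zero ℚ.+ sumℚ I (λ i → f (suc i))
sumℚ {suc n} (false ∷ I) f = sumℚ I (λ i → f (suc i))

IsKSubset : ∀ {n} → ℕ → Subset n → Set
IsKSubset k I = ∣ I ∣ ≡ k

_/ₖ_ : ℤ → ℕ → ℚ
z /ₖ zero  = 0ℚ
z /ₖ suc k = z ℚ./ suc k

ℕ/ₖ : ℕ → ℕ → ℚ
ℕ/ₖ d k = (ℤ.+_ d) /ₖ k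

distSum : ∀ {n} {Q : Digraph} → (Fin (m Q) → Fin (m Q) → ℕ) →
          (Fin n → Fin (m Q)) → Subset n → Fin (m Q) → ℕ
distSum δ z I x = sumℕ I (λ i → δ x (z i))

IsDistMinimizer : ∀ {n} {Q : Digraph} → (Fin (m Q) → Fin (m Q) → ℕ) →
                  (Fin n → Fin (m Q)) → Subset n → Fin (m Q) → Set
IsDistMinimizer {Q = Q} δ z I x = ∀ (y : Fin (m Q)) → distSum {Q = Q} δ z I x ℕ.≤ distSum {Q = Q} δ z I y

IsModel : (k n : ℕ) (Q : Digraph) → (Fin (m Q) → Fin (m Q) → ℕ) →
          (Fin n → Fin (m Q)) → (Subset n → ℚ) → Set
IsModel k n Q δ z π =
  ∀ (I : Subset n) → IsKSubset k I →
    ∃ λ (x : Fin (m Q)) → (IsDistMinimizer {Q = Q} δ z I x ×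
                                  π I ≡ ℚ.- ℕ/ₖ (distSum {Q = Q} δ z I x) k)

InMv : (k n : ℕ) (Q : Digraph) → (Fin (m Q) → Fin (m Q) → ℕ) →
       (Fin n → Fin (m Q)) → Fin (m Q) → Subset n → Set
InMv k n Q δ z v I = IsKSubset k I × IsDistMinimizer {Q = Q} δ z I v

bvec : (k n : ℕ) (Q : Digraph) → (Fin (m Q) → Fin (m Q) → ℕ) →
       (Fin n → Fin (m Q)) → Fin (m Q) → Fin n → ℚ
bvec k n Q δ z v i = ℕ/ₖ (δ v (z i)) k

shift : ∀ {n} → (Subset n → ℚ) → (Fin n → ℚ) → Subset n → ℚ
shift π x I = π I ℚ.- sumℚ I x

InMinSet : (k n : ℕ) → (Subset n → ℚ) → Subset n → Set
InMinSet k n π I = IsKSubset k I × (∀ J → IsKSubset k J → π I ℚ.≤ π J)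

MinTwice : ℚ → ℚ → ℚ → Set
MinTwice p q r = (p ≡ q × p ℚ.≤ r) ⊎ (p ≡ r × p ℚ.≤ q) ⊎ (q ≡ r × q ℚ.≤ p)

InDressian : (k n : ℕ) → (Subset n → ℚ) → Set
InDressian k n π =
  ∀ (S : Subset n) → ∣ S ∣ ≡ k ∸ 2 →
  ∀ (a b c d : Fin n) → a < b → b < c → c < d →
    a ∉ S → b ∉ S → c ∉ S → d ∉ S →
    MinTwice (π (S ∪ ⁅ a ⁆ ∪ ⁅ b ⁆) ℚ.+ π (S ∪ ⁅ c ⁆ ∪ ⁅ d ⁆))
             (π (S ∪ ⁅ a ⁆ ∪ ⁅ c ⁆) ℚ.+ π (S ∪ ⁅ b ⁆ ∪ ⁅ d ⁆))
             (π (S ∪ ⁅ a ⁆ ∪ ⁅ d ⁆) ℚ.+ π (S ∪ ⁅ b ⁆ ∪ ⁅ c ⁆))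

IsMatroidBases : (n : ℕ) → (Subset n → Set) → Set
IsMatroidBases n 𝓑 =
  (∃[ B ] 𝓑 B) ×
  (∀ B₁ B₂ → 𝓑 B₁ → 𝓑 B₂ → ∀ a → a ∈ B₁ → a ∉ B₂ →
     ∃[ b ] (b ∈ B₂ × b ∉ B₁ × 𝓑 ((B₁ - a) ∪ ⁅ b ⁆)))

module Submission where

-- For a k-set I the model equation gives π^(-b_v)_I = (Σ_{i∈I} δ(v,z_i) - Σ_Q(I)) / k ≥ 0, with
-- equality exactly when v is a distance minimizer for I; so when M_v is nonempty it is the set
-- M(π^(-b_v)) of minimizers of π^(-b_v). A shift adds the same amount to all three terms of a
-- three-term Plücker relation, so π^(-b_v) is again in the Dressian. The three-term relations give
-- valuated exchange: for a ∈ X ∖ Y some b ∈ Y ∖ X has g(X - a + b) + g(Y - b + a) ≤ g(X) + g(Y).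
-- This goes by induction on |X ∖ Y|: exchange a second a′ ∈ X ∖ Y into Y against the b ∈ Y ∖ X
-- minimising g(Y - b + a′) + g(X - a + b), recurse to obtain b₁, and compare the candidates b
-- and b₁ through one three-term relation on Y - b - b₁. Valuated exchange makes the minimizers of g
-- satisfy basis exchange.

open import Defs
open import Data.Nat using (ℕ; _≤_)
open import Data.Fin using (Fin)
open import Data.Fin.Subset using (Subset)
open import Data.Rational using (ℚ; -_)
open import Data.Product using (_×_; ∃-syntax)
open import Function.Bundles using (_⇔_)

open import Data.Bool using (true; false)
open import Data.Empty using (⊥-elim)
open import Data.Fin using (zero; suc; _<_; _≟_)
import Data.Fin.Properties as Fin
open import Data.Fin.Subset using (_∈_; _∉_; _∪_; _∩_; _─_; _-_; ⁅_⁆; ∣_∣; Nonempty)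
open import Data.Fin.Subset.Properties
  using ( _∈?_; nonempty?; drop-there; x∈⁅x⁆; x∉⁅y⁆⇒x≢y; x∈⁅y⁆⇒x≡y; x∈p∪q⁺; x∈p∪q⁻
        ; x∈p∧x∉q⇒x∈p─q; x∈p∧x≢y⇒x∈p-y; p─q⊆p; p─⊥≡p; p─x─y≡p─y─x; p─q─r≡p─q∪r
        ; ∪-assoc; ∪-comm; ∪-identityʳ; ∩-comm; ⊆-antisym )
import Data.Integer as ℤ
import Data.Integer.Properties as ℤ
open import Data.Integer.Tactic.RingSolver using (solve-∀)
import Data.Nat as ℕ
import Data.Nat.Properties as ℕ
open import Data.Product as Prod using (∃; _,_; proj₁; proj₂)
open import Data.Rational as ℚ using (0ℚ; _+_; toℚᵘ)
import Data.Rational.Properties as ℚ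
open import Data.Rational.Solver using (module +-*-Solver)
open import Data.Rational.Unnormalised as ℚᵘ using (mkℚᵘ; *≡*; *≤*)
import Data.Rational.Unnormalised.Properties as ℚᵘ
open import Data.Sum as Sum using (_⊎_; inj₁; inj₂; [_,_]′)
open import Data.Vec using ([]; _∷_; here; there)
open import Function.Base using (_∘_; id)
open import Function.Bundles using (mk⇔; Equivalence)
open import Algebra.Properties.Group ℚ.+-0-group using (⁻¹-involutive)
open import Relation.Binary.Definitions using (tri<; tri≈; tri>)
open import Relation.Binary.PropositionalEquality
open import Relation.Nullary using (yes; no; contradiction)

private variable
  n : ℕ

x∈p─q⁻ : ∀ (p q : Subset n) {x} → x ∈ p ─ q → x ∈ p × x ∉ q
x∈p─q⁻ (true  ∷ p) (false ∷ q) {zero}  here        = here , λ ()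
x∈p─q⁻ (false ∷ p) (false ∷ q) {zero}  ()
x∈p─q⁻ (s     ∷ p) (true  ∷ q) {zero}  ()
x∈p─q⁻ (s     ∷ p) (t     ∷ q) {suc x} (there x∈) =
  Prod.map there (_∘ drop-there) (x∈p─q⁻ p q x∈)

x∈p-y⁻ : ∀ (p : Subset n) y {x} → x ∈ p - y → x ∈ p × x ≢ y
x∈p-y⁻ p y x∈ = Prod.map₂ x∉⁅y⁆⇒x≢y (x∈p─q⁻ p ⁅ y ⁆ x∈)

x∉p-x : ∀ (p : Subset n) x → x ∉ p - x
x∉p-x p x x∈ = proj₂ (x∈p-y⁻ p x x∈) refl

x∈p∧y∉p⇒x≢y : ∀ {p : Subset n} {x y} → x ∈ p → y ∉ p → x ≢ y
x∈p∧y∉p⇒x≢y x∈p y∉p refl = y∉p x∈p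

x∈p∪⁅y⁆∧x≢y⇒x∈p : ∀ (p : Subset n) {x y} → x ∈ p ∪ ⁅ y ⁆ → x ≢ y → x ∈ p
x∈p∪⁅y⁆∧x≢y⇒x∈p p {y = y} x∈ x≢y =
  [ id , (λ x∈⁅y⁆ → contradiction (x∈⁅y⁆⇒x≡y y x∈⁅y⁆) x≢y) ]′ (x∈p∪q⁻ p ⁅ y ⁆ x∈)

x∉p∧x≢y⇒x∉p∪⁅y⁆ : ∀ {p : Subset n} {x y} → x ∉ p → x ≢ y → x ∉ p ∪ ⁅ y ⁆
x∉p∧x≢y⇒x∉p∪⁅y⁆ {p = p} {y = y} x∉p x≢y x∈ =
  [ x∉p , x≢y ∘ x∈⁅y⁆⇒x≡y y ]′ (x∈p∪q⁻ p ⁅ y ⁆ x∈)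

x∈p⇒suc∣p-x∣≡∣p∣ : ∀ (p : Subset n) {x} → x ∈ p → ℕ.suc ∣ p - x ∣ ≡ ∣ p ∣
x∈p⇒suc∣p-x∣≡∣p∣ (true  ∷ p) {zero}  here        = cong (ℕ.suc ∘ ∣_∣) (p─⊥≡p p)
x∈p⇒suc∣p-x∣≡∣p∣ (true  ∷ p) {suc x} (there x∈p) = cong ℕ.suc (x∈p⇒suc∣p-x∣≡∣p∣ p x∈p)
x∈p⇒suc∣p-x∣≡∣p∣ (false ∷ p) {suc x} (there x∈p) = x∈p⇒suc∣p-x∣≡∣p∣ p x∈p

x∉p⇒∣p∪⁅x⁆∣≡suc∣p∣ : ∀ (p : Subset n) {x} → x ∉ p → ∣ p ∪ ⁅ x ⁆ ∣ ≡ ℕ.suc ∣ p ∣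
x∉p⇒∣p∪⁅x⁆∣≡suc∣p∣ (true  ∷ p) {zero}  x∉p = ⊥-elim (x∉p here)
x∉p⇒∣p∪⁅x⁆∣≡suc∣p∣ (false ∷ p) {zero}  x∉p = cong (ℕ.suc ∘ ∣_∣) (∪-identityʳ p)
x∉p⇒∣p∪⁅x⁆∣≡suc∣p∣ (true  ∷ p) {suc x} x∉p = cong ℕ.suc (x∉p⇒∣p∪⁅x⁆∣≡suc∣p∣ p (x∉p ∘ there))
x∉p⇒∣p∪⁅x⁆∣≡suc∣p∣ (false ∷ p) {suc x} x∉p = x∉p⇒∣p∪⁅x⁆∣≡suc∣p∣ p (x∉p ∘ there)

∣p-x∪⁅y⁆∣≡∣p∣ : ∀ (p : Subset n) {x y} → x ∈ p → y ∉ p → ∣ (p - x) ∪ ⁅ y ⁆ ∣ ≡ ∣ p ∣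
∣p-x∪⁅y⁆∣≡∣p∣ p {x} x∈p y∉p =
  trans (x∉p⇒∣p∪⁅x⁆∣≡suc∣p∣ (p - x) (y∉p ∘ p─q⊆p p ⁅ x ⁆)) (x∈p⇒suc∣p-x∣≡∣p∣ p x∈p)

∣p∣≡∣p∩q∣+∣p─q∣ : ∀ (p q : Subset n) → ∣ p ∣ ≡ ∣ p ∩ q ∣ ℕ.+ ∣ p ─ q ∣
∣p∣≡∣p∩q∣+∣p─q∣ []          []          = refl
∣p∣≡∣p∩q∣+∣p─q∣ (true  ∷ p) (true  ∷ q) = cong ℕ.suc (∣p∣≡∣p∩q∣+∣p─q∣ p q)
∣p∣≡∣p∩q∣+∣p─q∣ (true  ∷ p) (false ∷ q) =
  trans (cong ℕ.suc (∣p∣≡∣p∩q∣+∣p─q∣ p q)) (sym (ℕ.+-suc _ _))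
∣p∣≡∣p∩q∣+∣p─q∣ (false ∷ p) (true  ∷ q) = ∣p∣≡∣p∩q∣+∣p─q∣ p q
∣p∣≡∣p∩q∣+∣p─q∣ (false ∷ p) (false ∷ q) = ∣p∣≡∣p∩q∣+∣p─q∣ p q

∣p∣≡∣q∣⇒∣p─q∣≡∣q─p∣ : ∀ (p q : Subset n) → ∣ p ∣ ≡ ∣ q ∣ → ∣ p ─ q ∣ ≡ ∣ q ─ p ∣
∣p∣≡∣q∣⇒∣p─q∣≡∣q─p∣ p q ∣p∣≡∣q∣ = ℕ.+-cancelˡ-≡ ∣ p ∩ q ∣ _ _ (begin
  ∣ p ∩ q ∣ ℕ.+ ∣ p ─ q ∣  ≡⟨ ∣p∣≡∣p∩q∣+∣p─q∣ p q ⟨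
  ∣ p ∣                    ≡⟨ ∣p∣≡∣q∣ ⟩
  ∣ q ∣                    ≡⟨ ∣p∣≡∣p∩q∣+∣p─q∣ q p ⟩
  ∣ q ∩ p ∣ ℕ.+ ∣ q ─ p ∣  ≡⟨ cong (λ r → ∣ r ∣ ℕ.+ ∣ q ─ p ∣) (∩-comm q p) ⟩
  ∣ p ∩ q ∣ ℕ.+ ∣ q ─ p ∣  ∎)
  where open ≡-Reasoning

∣p∣≡suc⇒Nonempty : ∀ (p : Subset n) {c} → ∣ p ∣ ≡ ℕ.suc c → Nonempty p
∣p∣≡suc⇒Nonempty (true  ∷ p) _      = zero , here
∣p∣≡suc⇒Nonempty (false ∷ p) ∣p∣≡1+c = Prod.map suc there (∣p∣≡suc⇒Nonempty p ∣p∣≡1+c)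

∣p∣≡1⇒unique : ∀ (p : Subset n) {x y} → ∣ p ∣ ≡ 1 → x ∈ p → y ∈ p → y ≡ x
∣p∣≡1⇒unique p {x} {y} ∣p∣≡1 x∈p y∈p with y ≟ x
... | yes y≡x = y≡x
... | no  y≢x = contradiction (trans ∣p-x-y∣+1≡∣p-x∣ ∣p-x∣≡0) λ ()
  where
  ∣p-x-y∣+1≡∣p-x∣ = x∈p⇒suc∣p-x∣≡∣p∣ (p - x) (x∈p∧x≢y⇒x∈p-y y∈p y≢x)
  ∣p-x∣≡0 = ℕ.suc-injective (trans (x∈p⇒suc∣p-x∣≡∣p∣ p x∈p) ∣p∣≡1)

∣p∣≡2+⇒other : ∀ (p : Subset n) {c x} → ∣ p ∣ ≡ 2 ℕ.+ c → x ∈ p → ∃[ y ] (y ∈ p × y ≢ x)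
∣p∣≡2+⇒other p {x = x} ∣p∣≡2+c x∈p =
  Prod.map₂ (x∈p-y⁻ p x)
    (∣p∣≡suc⇒Nonempty (p - x) (ℕ.suc-injective (trans (x∈p⇒suc∣p-x∣≡∣p∣ p x∈p) ∣p∣≡2+c)))

[p-x]∪⁅x⁆≡p : ∀ (p : Subset n) {x} → x ∈ p → (p - x) ∪ ⁅ x ⁆ ≡ p
[p-x]∪⁅x⁆≡p (true  ∷ p) {zero}  here        = cong (true ∷_) (trans (∪-identityʳ _) (p─⊥≡p p))
[p-x]∪⁅x⁆≡p (true  ∷ p) {suc x} (there x∈p) = cong (true ∷_) ([p-x]∪⁅x⁆≡p p x∈p)
[p-x]∪⁅x⁆≡p (false ∷ p) {suc x} (there x∈p) = cong (false ∷_) ([p-x]∪⁅x⁆≡p p x∈p)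

[p∪⁅y⁆]-x≡[p-x]∪⁅y⁆ : ∀ (p : Subset n) {x y} → x ≢ y → (p ∪ ⁅ y ⁆) - x ≡ (p - x) ∪ ⁅ y ⁆
[p∪⁅y⁆]-x≡[p-x]∪⁅y⁆ (s ∷ p) {zero}  {zero}  x≢y = contradiction refl x≢y
[p∪⁅y⁆]-x≡[p-x]∪⁅y⁆ (s ∷ p) {zero}  {suc y} _   =
  cong (false ∷_) (trans (p─⊥≡p _) (cong (_∪ ⁅ y ⁆) (sym (p─⊥≡p p))))
[p∪⁅y⁆]-x≡[p-x]∪⁅y⁆ (s ∷ p) {suc x} {zero}  _   =
  cong (_ ∷_) (trans (cong (_- x) (∪-identityʳ p)) (sym (∪-identityʳ _)))
[p∪⁅y⁆]-x≡[p-x]∪⁅y⁆ (s ∷ p) {suc x} {suc y} x≢y =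
  cong (_ ∷_) ([p∪⁅y⁆]-x≡[p-x]∪⁅y⁆ p (x≢y ∘ cong suc))

x∉p⇒p─[q-x]≡p─q : ∀ (p q : Subset n) {x} → x ∉ p → p ─ (q - x) ≡ p ─ q
x∉p⇒p─[q-x]≡p─q (true  ∷ p) (t     ∷ q) {zero}  x∉p = ⊥-elim (x∉p here)
x∉p⇒p─[q-x]≡p─q (false ∷ p) (true  ∷ q) {zero}  _   = cong (false ∷_) (cong (p ─_) (p─⊥≡p q))
x∉p⇒p─[q-x]≡p─q (false ∷ p) (false ∷ q) {zero}  _   = cong (false ∷_) (cong (p ─_) (p─⊥≡p q))
x∉p⇒p─[q-x]≡p─q (s     ∷ p) (true  ∷ q) {suc x} x∉p =
  cong (false ∷_) (x∉p⇒p─[q-x]≡p─q p q (x∉p ∘ there))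
x∉p⇒p─[q-x]≡p─q (s     ∷ p) (false ∷ q) {suc x} x∉p =
  cong (s ∷_) (x∉p⇒p─[q-x]≡p─q p q (x∉p ∘ there))

single-exchange : ∀ (X Y : Subset n) {a b} → ∣ X ─ Y ∣ ≡ 1 → ∣ Y ─ X ∣ ≡ 1 →
                  a ∈ X ─ Y → b ∈ Y ─ X → (X - a) ∪ ⁅ b ⁆ ≡ Y
single-exchange X Y {a} {b} ∣X─Y∣≡1 ∣Y─X∣≡1 a∈X─Y b∈Y─X = ⊆-antisym ⊆Y Y⊆
  where
  ⊆Y : ∀ {i} → i ∈ (X - a) ∪ ⁅ b ⁆ → i ∈ Y
  ⊆Y {i} i∈ with x∈p∪q⁻ (X - a) ⁅ b ⁆ i∈ | i ∈? Y
  ... | _             | yes i∈Y = i∈Y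
  ... | inj₂ i∈⁅b⁆    | no  _   = subst (_∈ Y) (sym (x∈⁅y⁆⇒x≡y b i∈⁅b⁆)) (proj₁ (x∈p─q⁻ Y X b∈Y─X))
  ... | inj₁ i∈X-a    | no  i∉Y = contradiction (∣p∣≡1⇒unique (X ─ Y) ∣X─Y∣≡1 a∈X─Y i∈X─Y) i≢a
    where
    i∈X = proj₁ (x∈p-y⁻ X a i∈X-a)
    i≢a = proj₂ (x∈p-y⁻ X a i∈X-a)
    i∈X─Y = x∈p∧x∉q⇒x∈p─q i∈X i∉Y
  Y⊆ : ∀ {i} → i ∈ Y → i ∈ (X - a) ∪ ⁅ b ⁆
  Y⊆ {i} i∈Y with i ∈? X
  ... | yes i∈X = x∈p∪q⁺ (inj₁ (x∈p∧x≢y⇒x∈p-y i∈X (x∈p∧y∉p⇒x≢y i∈Y (proj₂ (x∈p─q⁻ X Y a∈X─Y)))))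
  ... | no  i∉X = x∈p∪q⁺ (inj₂ (subst (_∈ ⁅ b ⁆)
                    (sym (∣p∣≡1⇒unique (Y ─ X) ∣Y─X∣≡1 b∈Y─X (x∈p∧x∉q⇒x∈p─q i∈Y i∉X))) (x∈⁅x⁆ b)))

+-cancelʳ-≤ : ∀ r {p q} → p + r ℚ.≤ q + r → p ℚ.≤ q
+-cancelʳ-≤ r {p} {q} = subst₂ ℚ._≤_ (+r-r p) (+r-r q) ∘ ℚ.+-monoˡ-≤ (- r)
  where
  +r-r : ∀ x → x + r + - r ≡ x
  +r-r x = trans (ℚ.+-assoc x r (- r)) (trans (cong (x +_) (ℚ.+-inverseʳ r)) (ℚ.+-identityʳ x))

+-cancelˡ-≤ : ∀ r {p q} → r + p ℚ.≤ r + q → p ℚ.≤ q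
+-cancelˡ-≤ r {p} {q} = +-cancelʳ-≤ r ∘ subst₂ ℚ._≤_ (ℚ.+-comm r p) (ℚ.+-comm r q)

p≤q⇒0≤-p+q : ∀ {p q} → p ℚ.≤ q → 0ℚ ℚ.≤ - p + q
p≤q⇒0≤-p+q {p} {q} = subst (ℚ._≤ - p + q) (ℚ.+-inverseˡ p) ∘ ℚ.+-monoʳ-≤ (- p)

-p+q≤0⇔q≤p : ∀ {p q} → - p + q ℚ.≤ 0ℚ ⇔ q ℚ.≤ p
-p+q≤0⇔q≤p {p} {q} = mk⇔
  (+-cancelˡ-≤ (- p) ∘ subst (- p + q ℚ.≤_) (sym (ℚ.+-inverseˡ p)))
  (subst (- p + q ℚ.≤_) (ℚ.+-inverseˡ p) ∘ ℚ.+-monoʳ-≤ (- p))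

mkℚᵘ-homo-+ : ∀ a b k-1 → mkℚᵘ (ℤ.+ a) k-1 ℚᵘ.+ mkℚᵘ (ℤ.+ b) k-1 ℚᵘ.≃ mkℚᵘ (ℤ.+ (a ℕ.+ b)) k-1
mkℚᵘ-homo-+ a b k-1 = *≡* (begin
  (ℤ.+ a ℤ.* K ℤ.+ ℤ.+ b ℤ.* K) ℤ.* K  ≡⟨ distrib (ℤ.+ a) (ℤ.+ b) K ⟩
  (ℤ.+ a ℤ.+ ℤ.+ b) ℤ.* (K ℤ.* K)      ≡⟨ cong₂ ℤ._*_ (ℤ.pos-+ a b) (ℤ.pos-* k k) ⟨
  ℤ.+ (a ℕ.+ b) ℤ.* ℤ.+ (k ℕ.* k)      ∎)
  where
  open ≡-Reasoning
  k = ℕ.suc k-1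
  K = ℤ.+ k
  distrib : ∀ x y z → (x ℤ.* z ℤ.+ y ℤ.* z) ℤ.* z ≡ (x ℤ.+ y) ℤ.* (z ℤ.* z)
  distrib = solve-∀

toℚᵘ-ℕ/ₖ : ∀ a k-1 → toℚᵘ (ℕ/ₖ a (ℕ.suc k-1)) ℚᵘ.≃ mkℚᵘ (ℤ.+ a) k-1
toℚᵘ-ℕ/ₖ a k-1 = ℚ.toℚᵘ-fromℚᵘ (mkℚᵘ (ℤ.+ a) k-1)

ℕ/ₖ-homo-+ : ∀ a b k-1 → ℕ/ₖ (a ℕ.+ b) (ℕ.suc k-1) ≡ ℕ/ₖ a (ℕ.suc k-1) + ℕ/ₖ b (ℕ.suc k-1)
ℕ/ₖ-homo-+ a b k-1 = ℚ.toℚᵘ-injective (begin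
  toℚᵘ (ℕ/ₖ (a ℕ.+ b) k)                  ≈⟨ toℚᵘ-ℕ/ₖ (a ℕ.+ b) k-1 ⟩
  mkℚᵘ (ℤ.+ (a ℕ.+ b)) k-1                ≈⟨ mkℚᵘ-homo-+ a b k-1 ⟨
  mkℚᵘ (ℤ.+ a) k-1 ℚᵘ.+ mkℚᵘ (ℤ.+ b) k-1  ≈⟨ ℚᵘ.+-cong (toℚᵘ-ℕ/ₖ a k-1) (toℚᵘ-ℕ/ₖ b k-1) ⟨
  toℚᵘ (ℕ/ₖ a k) ℚᵘ.+ toℚᵘ (ℕ/ₖ b k)      ≈⟨ ℚ.toℚᵘ-homo-+ (ℕ/ₖ a k) (ℕ/ₖ b k) ⟨
  toℚᵘ (ℕ/ₖ a k + ℕ/ₖ b k)                ∎)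
  where
  open import Relation.Binary.Reasoning.Setoid ℚᵘ.≃-setoid
  k = ℕ.suc k-1

ℕ/ₖ-mono-≤ : ∀ {a b} k-1 → a ℕ.≤ b → ℕ/ₖ a (ℕ.suc k-1) ℚ.≤ ℕ/ₖ b (ℕ.suc k-1)
ℕ/ₖ-mono-≤ {a} {b} k-1 a≤b = ℚ.toℚᵘ-cancel-≤
  (ℚᵘ.≤-respʳ-≃ (ℚᵘ.≃-sym (toℚᵘ-ℕ/ₖ b k-1)) (ℚᵘ.≤-respˡ-≃ (ℚᵘ.≃-sym (toℚᵘ-ℕ/ₖ a k-1))
    (*≤* (ℤ.*-monoʳ-≤-nonNeg (ℤ.+ ℕ.suc k-1) (ℤ.+≤+ a≤b)))))

ℕ/ₖ-cancel-≤ : ∀ {a b} k-1 → ℕ/ₖ a (ℕ.suc k-1) ℚ.≤ ℕ/ₖ b (ℕ.suc k-1) → a ℕ.≤ b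
ℕ/ₖ-cancel-≤ {a} {b} k-1 a/k≤b/k = ℤ.drop‿+≤+ (ℤ.*-cancelʳ-≤-pos (ℤ.+ a) (ℤ.+ b) (ℤ.+ ℕ.suc k-1)
  (ℚᵘ.drop-*≤* (ℚᵘ.≤-respʳ-≃ (toℚᵘ-ℕ/ₖ b k-1) (ℚᵘ.≤-respˡ-≃ (toℚᵘ-ℕ/ₖ a k-1)
    (ℚ.toℚᵘ-mono-≤ a/k≤b/k)))))

sumℚ-neg : ∀ (I : Subset n) f → sumℚ I (λ i → - f i) ≡ - sumℚ I f
sumℚ-neg []          f = refl
sumℚ-neg (true  ∷ I) f =
  trans (cong (- f zero +_) (sumℚ-neg I (f ∘ suc)))
        (sym (ℚ.neg-distrib-+ (f zero) (sumℚ I (f ∘ suc))))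
sumℚ-neg (false ∷ I) f = sumℚ-neg I (f ∘ suc)

sumℚ-ℕ/ₖ : ∀ (I : Subset n) f k-1 → sumℚ I (λ i → ℕ/ₖ (f i) (ℕ.suc k-1)) ≡ ℕ/ₖ (sumℕ I f) (ℕ.suc k-1)
sumℚ-ℕ/ₖ []          f k-1 = sym (ℚ.0/n≡0 (ℕ.suc k-1))
sumℚ-ℕ/ₖ (true  ∷ I) f k-1 =
  trans (cong (ℕ/ₖ (f zero) (ℕ.suc k-1) +_) (sumℚ-ℕ/ₖ I (f ∘ suc) k-1))
        (sym (ℕ/ₖ-homo-+ (f zero) _ k-1))
sumℚ-ℕ/ₖ (false ∷ I) f k-1 = sumℚ-ℕ/ₖ I (f ∘ suc) k-1

sumℚ-∪⁅⁆ : ∀ (S : Subset n) x {a} → a ∉ S → sumℚ (S ∪ ⁅ a ⁆) x ≡ sumℚ S x + x a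
sumℚ-∪⁅⁆ (true  ∷ S) x {zero}  a∉S = ⊥-elim (a∉S here)
sumℚ-∪⁅⁆ (false ∷ S) x {zero}  _   =
  trans (cong (λ T → x zero + sumℚ T (x ∘ suc)) (∪-identityʳ S)) (ℚ.+-comm (x zero) (sumℚ S (x ∘ suc)))
sumℚ-∪⁅⁆ (true  ∷ S) x {suc a} a∉S =
  trans (cong (x zero +_) (sumℚ-∪⁅⁆ S (x ∘ suc) (a∉S ∘ there)))
        (sym (ℚ.+-assoc (x zero) (sumℚ S (x ∘ suc)) (x (suc a))))
sumℚ-∪⁅⁆ (false ∷ S) x {suc a} a∉S = sumℚ-∪⁅⁆ S (x ∘ suc) (a∉S ∘ there)

sumℚ-∪⁅⁆∪⁅⁆ : ∀ (S : Subset n) x {a b} → a ∉ S → b ∉ S → b ≢ a →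
              sumℚ (S ∪ ⁅ a ⁆ ∪ ⁅ b ⁆) x ≡ sumℚ S x + x a + x b
sumℚ-∪⁅⁆∪⁅⁆ S x {a} {b} a∉S b∉S b≢a = begin
  sumℚ (S ∪ ⁅ a ⁆ ∪ ⁅ b ⁆) x    ≡⟨ cong (λ T → sumℚ T x) (∪-assoc S ⁅ a ⁆ ⁅ b ⁆) ⟨
  sumℚ ((S ∪ ⁅ a ⁆) ∪ ⁅ b ⁆) x  ≡⟨ sumℚ-∪⁅⁆ (S ∪ ⁅ a ⁆) x (x∉p∧x≢y⇒x∉p∪⁅y⁆ b∉S b≢a) ⟩
  sumℚ (S ∪ ⁅ a ⁆) x + x b      ≡⟨ cong (_+ x b) (sumℚ-∪⁅⁆ S x a∉S) ⟩
  sumℚ S x + x a + x b          ∎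
  where open ≡-Reasoning

shift-+ : ∀ (π : Subset n → ℚ) x A B →
          shift π x A + shift π x B ≡ (π A + π B) + - (sumℚ A x + sumℚ B x)
shift-+ π x A B = solve 4 (λ p q u w → (p :- u) :+ (q :- w) := (p :+ q) :- (u :+ w)) refl
  (π A) (π B) (sumℚ A x) (sumℚ B x)
  where open +-*-Solver

-- Three-term Plücker relations

MinTwice-cong : ∀ {p q r p′ q′ r′} → p ≡ p′ → q ≡ q′ → r ≡ r′ → MinTwice p q r → MinTwice p′ q′ r′
MinTwice-cong refl refl refl = id

MinTwice-swap₁₂ : ∀ {p q r} → MinTwice p q r → MinTwice q p r
MinTwice-swap₁₂ (inj₁ (p≡q , p≤r)) = inj₁ (sym p≡q , subst (ℚ._≤ _) p≡q p≤r)
MinTwice-swap₁₂ (inj₂ (inj₁ p≡r∧p≤q)) = inj₂ (inj₂ p≡r∧p≤q)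
MinTwice-swap₁₂ (inj₂ (inj₂ q≡r∧q≤p)) = inj₂ (inj₁ q≡r∧q≤p)

MinTwice-swap₂₃ : ∀ {p q r} → MinTwice p q r → MinTwice p r q
MinTwice-swap₂₃ (inj₁ p≡q∧p≤r) = inj₂ (inj₁ p≡q∧p≤r)
MinTwice-swap₂₃ (inj₂ (inj₁ p≡r∧p≤q)) = inj₁ p≡r∧p≤q
MinTwice-swap₂₃ (inj₂ (inj₂ (q≡r , q≤p))) = inj₂ (inj₂ (sym q≡r , subst (ℚ._≤ _) q≡r q≤p))

MinTwice-+ʳ : ∀ {p q r} c → MinTwice p q r → MinTwice (p + c) (q + c) (r + c)
MinTwice-+ʳ c = Sum.map translate (Sum.map translate translate)
  where
  translate : ∀ {x y w} → x ≡ y × x ℚ.≤ w → x + c ≡ y + c × x + c ℚ.≤ w + c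
  translate = Prod.map (cong (_+ c)) (ℚ.+-monoˡ-≤ c)

MinTwice⇒q≤p⊎r≤p : ∀ {p q r} → MinTwice p q r → q ℚ.≤ p ⊎ r ℚ.≤ p
MinTwice⇒q≤p⊎r≤p (inj₁ (p≡q , _))        = inj₁ (ℚ.≤-reflexive (sym p≡q))
MinTwice⇒q≤p⊎r≤p (inj₂ (inj₁ (p≡r , _))) = inj₂ (ℚ.≤-reflexive (sym p≡r))
MinTwice⇒q≤p⊎r≤p (inj₂ (inj₂ (_ , q≤p))) = inj₁ q≤p

ThreeTermPlücker : (Subset n → ℚ) → Subset n → (a b c d : Fin n) → Set
ThreeTermPlücker π S a b c d =
  MinTwice (π (S ∪ ⁅ a ⁆ ∪ ⁅ b ⁆) + π (S ∪ ⁅ c ⁆ ∪ ⁅ d ⁆))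
           (π (S ∪ ⁅ a ⁆ ∪ ⁅ c ⁆) + π (S ∪ ⁅ b ⁆ ∪ ⁅ d ⁆))
           (π (S ∪ ⁅ a ⁆ ∪ ⁅ d ⁆) + π (S ∪ ⁅ b ⁆ ∪ ⁅ c ⁆))

module _ {π : Subset n → ℚ} {S : Subset n} where

  private
    π-∪-comm : ∀ u w → π (S ∪ ⁅ u ⁆ ∪ ⁅ w ⁆) ≡ π (S ∪ ⁅ w ⁆ ∪ ⁅ u ⁆)
    π-∪-comm u w = cong (λ A → π (S ∪ A)) (∪-comm ⁅ u ⁆ ⁅ w ⁆)

  ThreeTermPlücker-swap₁₂ : ∀ {a b c d} → ThreeTermPlücker π S a b c d →
                            ThreeTermPlücker π S b a c d
  ThreeTermPlücker-swap₁₂ {a} {b} {c} {d} = MinTwice-cong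
    (cong (_+ π (S ∪ ⁅ c ⁆ ∪ ⁅ d ⁆)) (π-∪-comm a b))
    (ℚ.+-comm (π (S ∪ ⁅ a ⁆ ∪ ⁅ d ⁆)) (π (S ∪ ⁅ b ⁆ ∪ ⁅ c ⁆)))
    (ℚ.+-comm (π (S ∪ ⁅ a ⁆ ∪ ⁅ c ⁆)) (π (S ∪ ⁅ b ⁆ ∪ ⁅ d ⁆)))
    ∘ MinTwice-swap₂₃

  ThreeTermPlücker-swap₂₃ : ∀ {a b c d} → ThreeTermPlücker π S a b c d →
                            ThreeTermPlücker π S a c b d
  ThreeTermPlücker-swap₂₃ {a} {b} {c} {d} =
    MinTwice-cong refl refl (cong (π (S ∪ ⁅ a ⁆ ∪ ⁅ d ⁆) +_) (π-∪-comm b c)) ∘ MinTwice-swap₁₂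

  ThreeTermPlücker-swap₃₄ : ∀ {a b c d} → ThreeTermPlücker π S a b c d →
                            ThreeTermPlücker π S a b d c
  ThreeTermPlücker-swap₃₄ {a} {b} {c} {d} =
    MinTwice-cong (cong (π (S ∪ ⁅ a ⁆ ∪ ⁅ b ⁆) +_) (π-∪-comm c d)) refl refl ∘ MinTwice-swap₂₃

module _ {P : Fin n → Fin n → Fin n → Fin n → Set}
         (swap₁₂ : ∀ {a b c d} → P a b c d → P b a c d)
         (swap₂₃ : ∀ {a b c d} → P a b c d → P a c b d)
         (swap₃₄ : ∀ {a b c d} → P a b c d → P a b d c)
         (increasing : ∀ {a b c d} → a < b → b < c → c < d → P a b c d) where

  private
    insert₄ : ∀ {a b c d} → a < b → b < c → d ≢ a → d ≢ b → d ≢ c → P a b c d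
    insert₄ {a} {b} {c} {d} a<b b<c d≢a d≢b d≢c with Fin.<-cmp c d
    ... | tri< c<d _ _ = increasing a<b b<c c<d
    ... | tri≈ _ c≡d _ = contradiction (sym c≡d) d≢c
    ... | tri> _ _ d<c with Fin.<-cmp b d
    ...   | tri< b<d _ _ = swap₃₄ (increasing a<b b<d d<c)
    ...   | tri≈ _ b≡d _ = contradiction (sym b≡d) d≢b
    ...   | tri> _ _ d<b with Fin.<-cmp a d
    ...     | tri< a<d _ _ = swap₃₄ (swap₂₃ (increasing a<d d<b b<c))
    ...     | tri≈ _ a≡d _ = contradiction (sym a≡d) d≢a
    ...     | tri> _ _ d<a = swap₃₄ (swap₂₃ (swap₁₂ (increasing d<a a<b b<c)))

    insert₃ : ∀ {a b c d} → a < b → c ≢ a → c ≢ b → d ≢ a → d ≢ b → d ≢ c → P a b c d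
    insert₃ {a} {b} {c} a<b c≢a c≢b d≢a d≢b d≢c with Fin.<-cmp b c
    ... | tri< b<c _ _ = insert₄ a<b b<c d≢a d≢b d≢c
    ... | tri≈ _ b≡c _ = contradiction (sym b≡c) c≢b
    ... | tri> _ _ c<b with Fin.<-cmp a c
    ...   | tri< a<c _ _ = swap₂₃ (insert₄ a<c c<b d≢a d≢c d≢b)
    ...   | tri≈ _ a≡c _ = contradiction (sym a≡c) c≢a
    ...   | tri> _ _ c<a = swap₂₃ (swap₁₂ (insert₄ c<a a<b d≢c d≢a d≢b))

  increasing⇒distinct : ∀ {a b c d} → a ≢ b → a ≢ c → a ≢ d → b ≢ c → b ≢ d → c ≢ d → P a b c d
  increasing⇒distinct {a} {b} a≢b a≢c a≢d b≢c b≢d c≢d with Fin.<-cmp a b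
  ... | tri< a<b _ _ = insert₃ a<b (a≢c ∘ sym) (b≢c ∘ sym) (a≢d ∘ sym) (b≢d ∘ sym) (c≢d ∘ sym)
  ... | tri≈ _ a≡b _ = contradiction a≡b a≢b
  ... | tri> _ _ b<a = swap₁₂ (insert₃ b<a (b≢c ∘ sym) (a≢c ∘ sym) (b≢d ∘ sym) (a≢d ∘ sym) (c≢d ∘ sym))

ThreeTermRelations : ℕ → (Subset n → ℚ) → Set
ThreeTermRelations k π = ∀ S → ∣ S ∣ ≡ k ℕ.∸ 2 → ∀ {a b c d} →
  a ≢ b → a ≢ c → a ≢ d → b ≢ c → b ≢ d → c ≢ d →
  a ∉ S → b ∉ S → c ∉ S → d ∉ S → ThreeTermPlücker π S a b c d

InDressian⇒ThreeTermRelations : ∀ k (π : Subset n → ℚ) → InDressian k n π → ThreeTermRelations k π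
InDressian⇒ThreeTermRelations k π dr S ∣S∣ =
  increasing⇒distinct {P = λ a b c d → a ∉ S → b ∉ S → c ∉ S → d ∉ S → ThreeTermPlücker π S a b c d}
    (λ P b∉S a∉S c∉S d∉S → ThreeTermPlücker-swap₁₂ {π = π} {S} (P a∉S b∉S c∉S d∉S))
    (λ P a∉S c∉S b∉S d∉S → ThreeTermPlücker-swap₂₃ {π = π} {S} (P a∉S b∉S c∉S d∉S))
    (λ P a∉S b∉S d∉S c∉S → ThreeTermPlücker-swap₃₄ {π = π} {S} (P a∉S b∉S c∉S d∉S))
    (λ a<b b<c c<d → dr S ∣S∣ _ _ _ _ a<b b<c c<d)

shift-InDressian : ∀ k (π : Subset n → ℚ) x → InDressian k n π → InDressian k n (shift π x)
shift-InDressian {n = n} k π x dr S ∣S∣ a b c d a<b b<c c<d a∉S b∉S c∉S d∉S =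
  MinTwice-cong (shifted a b c d refl) (shifted a c b d ac∣bd) (shifted a d b c ad∣bc)
    (MinTwice-+ʳ (- Σ a b c d) (dr S ∣S∣ a b c d a<b b<c c<d a∉S b∉S c∉S d∉S))
  where
  open +-*-Solver
  open ≡-Reasoning
  πΣ Σ : Fin n → Fin n → Fin n → Fin n → ℚ
  πΣ u w u′ w′ = π (S ∪ ⁅ u ⁆ ∪ ⁅ w ⁆) + π (S ∪ ⁅ u′ ⁆ ∪ ⁅ w′ ⁆)
  Σ  u w u′ w′ = sumℚ (S ∪ ⁅ u ⁆ ∪ ⁅ w ⁆) x + sumℚ (S ∪ ⁅ u′ ⁆ ∪ ⁅ w′ ⁆) x
  shifted : ∀ u w u′ w′ → Σ u w u′ w′ ≡ Σ a b c d →
    πΣ u w u′ w′ + - Σ a b c d ≡ shift π x (S ∪ ⁅ u ⁆ ∪ ⁅ w ⁆) + shift π x (S ∪ ⁅ u′ ⁆ ∪ ⁅ w′ ⁆)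
  shifted u w u′ w′ Σ≡ = trans (cong ((πΣ u w u′ w′ +_) ∘ -_) (sym Σ≡)) (sym (shift-+ π x _ _))
  σ : Fin n → Fin n → ℚ
  σ u w = sumℚ S x + x u + x w
  expand : ∀ {u w u′ w′} → u ∉ S → w ∉ S → u′ ∉ S → w′ ∉ S → u < w → u′ < w′ →
           Σ u w u′ w′ ≡ σ u w + σ u′ w′
  expand u∉S w∉S u′∉S w′∉S u<w u′<w′ = cong₂ _+_
    (sumℚ-∪⁅⁆∪⁅⁆ S x u∉S w∉S (Fin.<⇒≢ u<w ∘ sym)) (sumℚ-∪⁅⁆∪⁅⁆ S x u′∉S w′∉S (Fin.<⇒≢ u′<w′ ∘ sym))
  a<c = Fin.<-trans a<b b<c
  ac∣bd : Σ a c b d ≡ Σ a b c d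
  ac∣bd = begin
    Σ a c b d      ≡⟨ expand a∉S c∉S b∉S d∉S a<c (Fin.<-trans b<c c<d) ⟩
    σ a c + σ b d  ≡⟨ solve 5 (λ s p q r t → (s :+ p :+ r) :+ (s :+ q :+ t)
                                          := (s :+ p :+ q) :+ (s :+ r :+ t))
                        refl (sumℚ S x) (x a) (x b) (x c) (x d) ⟩
    σ a b + σ c d  ≡⟨ expand a∉S b∉S c∉S d∉S a<b c<d ⟨
    Σ a b c d      ∎
  ad∣bc : Σ a d b c ≡ Σ a b c d
  ad∣bc = begin
    Σ a d b c      ≡⟨ expand a∉S d∉S b∉S c∉S (Fin.<-trans a<c c<d) b<c ⟩
    σ a d + σ b c  ≡⟨ solve 5 (λ s p q r t → (s :+ p :+ t) :+ (s :+ q :+ r)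
                                          := (s :+ p :+ q) :+ (s :+ r :+ t))
                        refl (sumℚ S x) (x a) (x b) (x c) (x d) ⟩
    σ a b + σ c d  ≡⟨ expand a∉S b∉S c∉S d∉S a<b c<d ⟨
    Σ a b c d      ∎

-- Valuated basis exchange

ValuatedExchange : ℕ → (Subset n → ℚ) → Set
ValuatedExchange k g = ∀ X Y → IsKSubset k X → IsKSubset k Y → ∀ {a} → a ∈ X → a ∉ Y →
  ∃[ b ] (b ∈ Y × b ∉ X × g ((X - a) ∪ ⁅ b ⁆) + g ((Y - b) ∪ ⁅ a ⁆) ℚ.≤ g X + g Y)

minimiser : ∀ (f : Fin n → ℚ) (p : Subset n) → Nonempty p →
            ∃[ x ] (x ∈ p × ∀ {y} → y ∈ p → f x ℚ.≤ f y)
minimiser f (s ∷ p) ne with nonempty? p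
minimiser f (false ∷ p) (suc x , there x∈p) | no ¬ne = contradiction (x , x∈p) ¬ne
minimiser f (true  ∷ p) _                    | no ¬ne =
  zero , here , λ { here → ℚ.≤-refl ; (there y∈p) → contradiction (_ , y∈p) ¬ne }
minimiser f (s ∷ p) _ | yes ne with minimiser (f ∘ suc) p ne
minimiser f (false ∷ p) _ | yes _ | x , x∈p , x-min =
  suc x , there x∈p , λ { (there y∈p) → x-min y∈p }
minimiser f (true  ∷ p) _ | yes _ | x , x∈p , x-min with ℚ.≤-total (f zero) (f (suc x))
... | inj₁ f0≤fx = zero , here , λ { here → ℚ.≤-refl ; (there y∈p) → ℚ.≤-trans f0≤fx (x-min y∈p) }
... | inj₂ fx≤f0 = suc x , there x∈p , λ { here → fx≤f0 ; (there y∈p) → x-min y∈p }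

three-term-exchange-≤ : ∀ (g : Subset n → ℚ) {X Y X₀ X₁ S T U V W} →
  MinTwice (g Y + g S) (g T + g V) (g U + g W) → g X₁ + g S ℚ.≤ g X + g W → g W + g X₀ ℚ.≤ g T + g X₁ →
  g X₀ + g V ℚ.≤ g X + g Y ⊎ g X₁ + g U ℚ.≤ g X + g Y
three-term-exchange-≤ g {X} {Y} {X₀} {X₁} {S} {T} {U} {V} {W} P x₁+s≤x+w w+x₀≤t+x₁ =
  Sum.map second-not-above third-not-above (MinTwice⇒q≤p⊎r≤p P)
  where
  open +-*-Solver
  open ℚ.≤-Reasoning
  x = g X ; y = g Y ; x₀ = g X₀ ; x₁ = g X₁ ; s = g S ; t = g T ; u = g U ; v = g V ; w = g W
  second-not-above : t + v ℚ.≤ y + s → x₀ + v ℚ.≤ x + y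
  second-not-above t+v≤y+s = +-cancelʳ-≤ (s + t + w + x₁) (begin
    (x₀ + v) + (s + t + w + x₁)     ≡⟨ solve 6 (λ x₀ v s t w x₁ → (x₀ :+ v) :+ (s :+ t :+ w :+ x₁)
                                          := (t :+ v) :+ (x₁ :+ s) :+ (w :+ x₀)) refl x₀ v s t w x₁ ⟩
    (t + v) + (x₁ + s) + (w + x₀)   ≤⟨ ℚ.+-mono-≤ (ℚ.+-mono-≤ t+v≤y+s x₁+s≤x+w) w+x₀≤t+x₁ ⟩
    (y + s) + (x + w) + (t + x₁)    ≡⟨ solve 6 (λ x y s t w x₁ → (y :+ s) :+ (x :+ w) :+ (t :+ x₁)
                                          := (x :+ y) :+ (s :+ t :+ w :+ x₁)) refl x y s t w x₁ ⟩
    (x + y) + (s + t + w + x₁)      ∎)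
  third-not-above : u + w ℚ.≤ y + s → x₁ + u ℚ.≤ x + y
  third-not-above u+w≤y+s = +-cancelʳ-≤ (s + w) (begin
    (x₁ + u) + (s + w)  ≡⟨ solve 4 (λ x₁ u s w → (x₁ :+ u) :+ (s :+ w) := (u :+ w) :+ (x₁ :+ s))
                              refl x₁ u s w ⟩
    (u + w) + (x₁ + s)  ≤⟨ ℚ.+-mono-≤ u+w≤y+s x₁+s≤x+w ⟩
    (y + s) + (x + w)   ≡⟨ solve 4 (λ x y s w → (y :+ s) :+ (x :+ w) := (x :+ y) :+ (s :+ w))
                              refl x y s w ⟩
    (x + y) + (s + w)   ∎)

module _ {k : ℕ} (g : Subset n → ℚ) (three-term : ThreeTermRelations (2 ℕ.+ k) g) where

  -- The relation on Y - b - b₁ for the quadruple b, b₁, a′, a, its six sets written in terms of Y.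
  three-term-around : ∀ {Y : Subset n} {b b₁ a a′} → ∣ Y ∣ ≡ 2 ℕ.+ k →
    b ∈ Y → b₁ ∈ Y - b → a ∉ Y → a′ ∉ Y → a′ ≢ a →
    MinTwice (g Y + g ((((Y - b) ∪ ⁅ a′ ⁆) - b₁) ∪ ⁅ a ⁆))
             (g ((Y - b₁) ∪ ⁅ a′ ⁆) + g ((Y - b) ∪ ⁅ a ⁆))
             (g ((Y - b₁) ∪ ⁅ a ⁆) + g ((Y - b) ∪ ⁅ a′ ⁆))
  three-term-around {Y} {b} {b₁} {a} {a′} ∣Y∣ b∈Y b₁∈Y-b a∉Y a′∉Y a′≢a =
    MinTwice-cong (g-pair (sym Y≡) (sym Y′-b₁∪a≡)) (g-pair (sym (Y-b₁∪≡ a′)) (sym (Y-b∪≡ a)))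
                  (g-pair (sym (Y-b₁∪≡ a)) (sym (Y-b∪≡ a′)))
      (three-term T ∣T∣ b≢b₁ (x∈p∧y∉p⇒x≢y b∈Y a′∉Y) (x∈p∧y∉p⇒x≢y b∈Y a∉Y)
                  (x∈p∧y∉p⇒x≢y b₁∈Y a′∉Y) (x∈p∧y∉p⇒x≢y b₁∈Y a∉Y) a′≢a
                  (x∉p-x Y b ∘ p─q⊆p (Y - b) ⁅ b₁ ⁆) (x∉p-x (Y - b) b₁) (a′∉Y ∘ T⊆Y) (a∉Y ∘ T⊆Y))
    where
    T = Y - b - b₁
    g-pair : ∀ {A A′ B B′} → A ≡ A′ → B ≡ B′ → g A + g B ≡ g A′ + g B′
    g-pair = cong₂ (λ A B → g A + g B)
    b₁∈Y = proj₁ (x∈p-y⁻ Y b b₁∈Y-b)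
    b≢b₁ : b ≢ b₁
    b≢b₁ = proj₂ (x∈p-y⁻ Y b b₁∈Y-b) ∘ sym
    T⊆Y : ∀ {i} → i ∈ T → i ∈ Y
    T⊆Y = p─q⊆p Y ⁅ b ⁆ ∘ p─q⊆p (Y - b) ⁅ b₁ ⁆
    ∣T∣ : ∣ T ∣ ≡ k
    ∣T∣ = ℕ.suc-injective (ℕ.suc-injective (trans (cong ℕ.suc (x∈p⇒suc∣p-x∣≡∣p∣ (Y - b) b₁∈Y-b))
                                                 (trans (x∈p⇒suc∣p-x∣≡∣p∣ Y b∈Y) ∣Y∣)))
    Y-b≡ : Y - b ≡ T ∪ ⁅ b₁ ⁆
    Y-b≡ = sym ([p-x]∪⁅x⁆≡p (Y - b) b₁∈Y-b)
    Y-b₁≡ : Y - b₁ ≡ T ∪ ⁅ b ⁆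
    Y-b₁≡ = trans (sym ([p-x]∪⁅x⁆≡p (Y - b₁) (x∈p∧x≢y⇒x∈p-y b∈Y b≢b₁)))
                  (cong (_∪ ⁅ b ⁆) (p─x─y≡p─y─x Y b₁ b))
    Y-b∪≡ : ∀ u → (Y - b) ∪ ⁅ u ⁆ ≡ T ∪ ⁅ b₁ ⁆ ∪ ⁅ u ⁆
    Y-b∪≡ u = trans (cong (_∪ ⁅ u ⁆) Y-b≡) (∪-assoc T ⁅ b₁ ⁆ ⁅ u ⁆)
    Y-b₁∪≡ : ∀ u → (Y - b₁) ∪ ⁅ u ⁆ ≡ T ∪ ⁅ b ⁆ ∪ ⁅ u ⁆
    Y-b₁∪≡ u = trans (cong (_∪ ⁅ u ⁆) Y-b₁≡) (∪-assoc T ⁅ b ⁆ ⁅ u ⁆)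
    Y≡ : Y ≡ T ∪ ⁅ b ⁆ ∪ ⁅ b₁ ⁆
    Y≡ = trans (sym ([p-x]∪⁅x⁆≡p Y b₁∈Y)) (Y-b₁∪≡ b₁)
    Y′-b₁∪a≡ : (((Y - b) ∪ ⁅ a′ ⁆) - b₁) ∪ ⁅ a ⁆ ≡ T ∪ ⁅ a′ ⁆ ∪ ⁅ a ⁆
    Y′-b₁∪a≡ = trans (cong (_∪ ⁅ a ⁆) ([p∪⁅y⁆]-x≡[p-x]∪⁅y⁆ (Y - b) (x∈p∧y∉p⇒x≢y b₁∈Y a′∉Y)))
                     (∪-assoc T ⁅ a′ ⁆ ⁅ a ⁆)

  exchange-at-distance : ∀ c X Y → ∣ X ∣ ≡ 2 ℕ.+ k → ∣ Y ∣ ≡ 2 ℕ.+ k → ∣ X ─ Y ∣ ≡ ℕ.suc c →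
    ∀ {a} → a ∈ X → a ∉ Y →
    ∃[ b ] (b ∈ Y × b ∉ X × g ((X - a) ∪ ⁅ b ⁆) + g ((Y - b) ∪ ⁅ a ⁆) ℚ.≤ g X + g Y)
  exchange-at-distance ℕ.zero X Y ∣X∣ ∣Y∣ ∣X─Y∣≡1 a∈X a∉Y =
    let ∣Y─X∣≡1 = trans (sym (∣p∣≡∣q∣⇒∣p─q∣≡∣q─p∣ X Y (trans ∣X∣ (sym ∣Y∣)))) ∣X─Y∣≡1
        a∈X─Y   = x∈p∧x∉q⇒x∈p─q a∈X a∉Y
        b , b∈Y─X = ∣p∣≡suc⇒Nonempty (Y ─ X) ∣Y─X∣≡1
        b∈Y , b∉X = x∈p─q⁻ Y X b∈Y─X
    in b , b∈Y , b∉X , ℚ.≤-reflexive (trans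
         (cong₂ (λ A B → g A + g B) (single-exchange X Y ∣X─Y∣≡1 ∣Y─X∣≡1 a∈X─Y b∈Y─X)
                                    (single-exchange Y X ∣Y─X∣≡1 ∣X─Y∣≡1 b∈Y─X a∈X─Y))
         (ℚ.+-comm (g Y) (g X)))
  exchange-at-distance (ℕ.suc c) X Y ∣X∣ ∣Y∣ ∣X─Y∣ {a} a∈X a∉Y =
    let a′ , a′∈X─Y , a′≢a = ∣p∣≡2+⇒other (X ─ Y) ∣X─Y∣ (x∈p∧x∉q⇒x∈p─q a∈X a∉Y)
        a′∈X , a′∉Y = x∈p─q⁻ X Y a′∈X─Y
        ∣Y─X∣ = trans (sym (∣p∣≡∣q∣⇒∣p─q∣≡∣q─p∣ X Y (trans ∣X∣ (sym ∣Y∣)))) ∣X─Y∣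
        b , b∈Y─X , b-min = minimiser (λ e → g ((Y - e) ∪ ⁅ a′ ⁆) + g ((X - a) ∪ ⁅ e ⁆)) (Y ─ X)
                                      (∣p∣≡suc⇒Nonempty (Y ─ X) ∣Y─X∣)
        b∈Y , b∉X = x∈p─q⁻ Y X b∈Y─X
        ∣X─Y′∣ = trans (cong ∣_∣ (trans (sym (p─q─r≡p─q∪r X (Y - b) ⁅ a′ ⁆))
                                        (cong (_- a′) (x∉p⇒p─[q-x]≡p─q X Y b∉X))))
                       (ℕ.suc-injective (trans (x∈p⇒suc∣p-x∣≡∣p∣ (X ─ Y) a′∈X─Y) ∣X─Y∣))
        a∉Y′ = x∉p∧x≢y⇒x∉p∪⁅y⁆ (a∉Y ∘ p─q⊆p Y ⁅ b ⁆) (a′≢a ∘ sym)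
        b₁ , b₁∈Y′ , b₁∉X , ih = exchange-at-distance c X ((Y - b) ∪ ⁅ a′ ⁆) ∣X∣
                                   (trans (∣p-x∪⁅y⁆∣≡∣p∣ Y b∈Y a′∉Y) ∣Y∣) ∣X─Y′∣ a∈X a∉Y′
        b₁∈Y-b = x∈p∪⁅y⁆∧x≢y⇒x∈p (Y - b) b₁∈Y′ (x∈p∧y∉p⇒x≢y a′∈X b₁∉X ∘ sym)
        b₁∈Y = proj₁ (x∈p-y⁻ Y b b₁∈Y-b)
    in [ (λ via-b → b , b∈Y , b∉X , via-b) , (λ via-b₁ → b₁ , b₁∈Y , b₁∉X , via-b₁) ]′
         (three-term-exchange-≤ g (three-term-around ∣Y∣ b∈Y b₁∈Y-b a∉Y a′∉Y a′≢a) ih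
                                (b-min (x∈p∧x∉q⇒x∈p─q b₁∈Y b₁∉X)))

  threeTermRelations⇒valuatedExchange : ValuatedExchange (2 ℕ.+ k) g
  threeTermRelations⇒valuatedExchange X Y ∣X∣ ∣Y∣ a∈X a∉Y = exchange-at-distance _ X Y ∣X∣ ∣Y∣
    (sym (x∈p⇒suc∣p-x∣≡∣p∣ (X ─ Y) (x∈p∧x∉q⇒x∈p─q a∈X a∉Y))) a∈X a∉Y

-- Minimum sets are matroids

IsMatroidBases-resp-⇔ : ∀ {P Q : Subset n → Set} →
                        (∀ B → P B ⇔ Q B) → IsMatroidBases n Q → IsMatroidBases n P
IsMatroidBases-resp-⇔ P⇔Q ((B , QB) , exchange) =
  (B , from (P⇔Q B) QB) ,
  λ B₁ B₂ PB₁ PB₂ a a∈B₁ a∉B₂ → Prod.map₂ (Prod.map₂ (Prod.map₂ (from (P⇔Q _))))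
    (exchange B₁ B₂ (to (P⇔Q B₁) PB₁) (to (P⇔Q B₂) PB₂) a a∈B₁ a∉B₂)
  where open Equivalence

valuatedExchange⇒minSet-isMatroidBases : ∀ {k} {g : Subset n → ℚ} →
  ValuatedExchange k g → ∃ (InMinSet k n g) → IsMatroidBases n (InMinSet k n g)
valuatedExchange⇒minSet-isMatroidBases {n = n} {k} {g} exchange B₀∈M = B₀∈M , basis-exchange
  where
  basis-exchange : ∀ B₁ B₂ → InMinSet k n g B₁ → InMinSet k n g B₂ → ∀ a → a ∈ B₁ → a ∉ B₂ →
                   ∃[ b ] (b ∈ B₂ × b ∉ B₁ × InMinSet k n g ((B₁ - a) ∪ ⁅ b ⁆))
  basis-exchange B₁ B₂ (∣B₁∣ , B₁-min) (∣B₂∣ , B₂-min) a a∈B₁ a∉B₂ =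
    let b , b∈B₂ , b∉B₁ , sum≤ = exchange B₁ B₂ ∣B₁∣ ∣B₂∣ a∈B₁ a∉B₂
        B₁′ = (B₁ - a) ∪ ⁅ b ⁆
        B₂′ = (B₂ - b) ∪ ⁅ a ⁆
        gB₁′≤gB₁ = +-cancelʳ-≤ (g B₂) (ℚ.≤-trans
          (ℚ.+-monoʳ-≤ (g B₁′) (B₂-min B₂′ (trans (∣p-x∪⁅y⁆∣≡∣p∣ B₂ b∈B₂ a∉B₂) ∣B₂∣))) sum≤)
    in b , b∈B₂ , b∉B₁ , trans (∣p-x∪⁅y⁆∣≡∣p∣ B₁ a∈B₁ b∉B₁) ∣B₁∣ ,
       λ J ∣J∣ → ℚ.≤-trans gB₁′≤gB₁ (B₁-min J ∣J∣)

-- The shifted model vector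

module _ {n : ℕ} (k-1 : ℕ) (Q : Digraph) (δ : Fin (m Q) → Fin (m Q) → ℕ) (z : Fin n → Fin (m Q))
         (π : Subset n → ℚ) (v : Fin (m Q)) where

  π⁻ᵇᵛ : Subset n → ℚ
  π⁻ᵇᵛ = shift π (λ i → - bvec (ℕ.suc k-1) n Q δ z v i)

  π⁻ᵇᵛ≡π+Σδ/k : ∀ I → π⁻ᵇᵛ I ≡ π I + ℕ/ₖ (distSum {Q = Q} δ z I v) (ℕ.suc k-1)
  π⁻ᵇᵛ≡π+Σδ/k I = cong (π I +_) (begin
    - sumℚ I (λ i → - b i)          ≡⟨ cong -_ (sumℚ-neg I b) ⟩
    - - sumℚ I b                    ≡⟨ ⁻¹-involutive _ ⟩
    sumℚ I b                        ≡⟨ sumℚ-ℕ/ₖ I (λ i → δ v (z i)) k-1 ⟩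
    ℕ/ₖ (distSum {Q = Q} δ z I v) k  ∎)
    where
    open ≡-Reasoning
    k = ℕ.suc k-1
    b = bvec k n Q δ z v

  module _ (model : IsModel (ℕ.suc k-1) n Q δ z π) where

    private
      D : Subset n → Fin (m Q) → ℕ
      D = distSum {Q = Q} δ z

    π⁻ᵇᵛ-gap : ∀ I → IsKSubset (ℕ.suc k-1) I → ∃[ y ] (IsDistMinimizer {Q = Q} δ z I y ×
                 π⁻ᵇᵛ I ≡ - ℕ/ₖ (D I y) (ℕ.suc k-1) + ℕ/ₖ (D I v) (ℕ.suc k-1))
    π⁻ᵇᵛ-gap I ∣I∣ =
      Prod.map₂ (Prod.map₂ (λ πI≡ → trans (π⁻ᵇᵛ≡π+Σδ/k I) (cong (_+ _) πI≡))) (model I ∣I∣)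

    π⁻ᵇᵛ-nonneg : ∀ I → IsKSubset (ℕ.suc k-1) I → 0ℚ ℚ.≤ π⁻ᵇᵛ I
    π⁻ᵇᵛ-nonneg I ∣I∣ = let y , y-min , π⁻ᵇᵛI≡ = π⁻ᵇᵛ-gap I ∣I∣ in
      subst (0ℚ ℚ.≤_) (sym π⁻ᵇᵛI≡) (p≤q⇒0≤-p+q (ℕ/ₖ-mono-≤ k-1 (y-min v)))

    distMinimizer⇔π⁻ᵇᵛ≤0 : ∀ I → IsKSubset (ℕ.suc k-1) I →
                           IsDistMinimizer {Q = Q} δ z I v ⇔ π⁻ᵇᵛ I ℚ.≤ 0ℚ
    distMinimizer⇔π⁻ᵇᵛ≤0 I ∣I∣ = let y , y-min , π⁻ᵇᵛI≡ = π⁻ᵇᵛ-gap I ∣I∣ in mk⇔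
      (λ v-min → subst (ℚ._≤ 0ℚ) (sym π⁻ᵇᵛI≡) (from -p+q≤0⇔q≤p (ℕ/ₖ-mono-≤ k-1 (v-min y))))
      (λ π⁻ᵇᵛI≤0 w → ℕ.≤-trans
        (ℕ/ₖ-cancel-≤ k-1 (to -p+q≤0⇔q≤p (subst (ℚ._≤ 0ℚ) π⁻ᵇᵛI≡ π⁻ᵇᵛI≤0))) (y-min w))
      where open Equivalence

    Mv⇔minSet : (∃[ I ] InMv (ℕ.suc k-1) n Q δ z v I) →
                ∀ I → InMv (ℕ.suc k-1) n Q δ z v I ⇔ InMinSet (ℕ.suc k-1) n π⁻ᵇᵛ I
    Mv⇔minSet (I₀ , ∣I₀∣ , v-min₀) I = mk⇔
      (λ (∣I∣ , v-min) → ∣I∣ , λ J ∣J∣ →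
        ℚ.≤-trans (to (distMinimizer⇔π⁻ᵇᵛ≤0 I ∣I∣) v-min) (π⁻ᵇᵛ-nonneg J ∣J∣))
      (λ (∣I∣ , I-min) → ∣I∣ , from (distMinimizer⇔π⁻ᵇᵛ≤0 I ∣I∣)
        (ℚ.≤-trans (I-min I₀ ∣I₀∣) (to (distMinimizer⇔π⁻ᵇᵛ≤0 I₀ ∣I₀∣) v-min₀)))
      where open Equivalence

proposition3p9 : (k n : ℕ) → 2 ≤ k →
    (Q : Digraph) (δ : Fin (m Q) → Fin (m Q) → ℕ) → IsDistance k Q δ →
    (z : Fin n → Fin (m Q)) (π : Subset n → ℚ) →
    InDressian k n π → IsModel k n Q δ z π →
    ∀ (v : Fin (m Q)) → (∃[ I ] InMv k n Q δ z v I) →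
      (∀ (I : Subset n) →
         InMv k n Q δ z v I ⇔ InMinSet k n (shift π (λ i → - bvec k n Q δ z v i)) I)
      × IsMatroidBases n (InMv k n Q δ z v)
-- δ need not be the distance function of Q: only the model equation is used.
proposition3p9 k@(ℕ.suc k-1@(ℕ.suc _)) n (ℕ.s≤s (ℕ.s≤s ℕ.z≤n)) Q δ _ z π dressian model v Mv≠∅ =
  Mv⇔M , IsMatroidBases-resp-⇔ Mv⇔M (valuatedExchange⇒minSet-isMatroidBases exchange M≠∅)
  where
  π′ : Subset n → ℚ
  π′ = π⁻ᵇᵛ k-1 Q δ z π v
  Mv⇔M : ∀ I → InMv k n Q δ z v I ⇔ InMinSet k n π′ I
  Mv⇔M = Mv⇔minSet k-1 Q δ z π v model Mv≠∅
  M≠∅ : ∃ (InMinSet k n π′)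
  M≠∅ = Prod.map₂ (λ {I} → Equivalence.to (Mv⇔M I)) Mv≠∅
  exchange : ValuatedExchange k π′
  exchange = threeTermRelations⇒valuatedExchange π′
    (InDressian⇒ThreeTermRelations k π′
      (shift-InDressian k π (λ i → - bvec k n Q δ z v i) dressian))
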